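{- We have $\liminf_{n\to\infty}\frac{\beta(n)}{n}=0$ and $\limsup_{n\to\infty}\frac{\beta(n)}{n}=1$.
   Context: For a positive integer $n$, $\rho(n)$ is the product of the distinct primes dividing $n$. For an integer $n\geqslant 2$, $\beta(n)$ is the largest positive integer $m<n$ such that $\rho(m)\mid n$ (equivalently, the largest integer less than $n$ dividing some power of $n$). -}

module Defs where

open import Data.Nat using (ℕ; zero; suc; _∸_)
open import Data.Nat.Divisibility using (_∣_; _∣?_)
open import Data.Nat.Primality using (Prime; prime?)
open import Data.List using (List; filter; upTo)
open import Data.Nat.ListAction using (product)
open import Data.Product using (_×_)
open import Data.Integer using (+_)
open import Data.Rational using (ℚ; 0ℚ; _/_)
open import Relation.Nullary using (yes; no)
open import Relation.Nullary.Decidable using (_×-dec_)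

-- the distinct primes dividing n (for n ≥ 1 all such primes are ≤ n)
primeDivisors : ℕ → List ℕ
primeDivisors n = filter (λ p → prime? p ×-dec p ∣? n) (upTo (suc n))

ρ : ℕ → ℕ
ρ n = product (primeDivisors n)

βsearch : ℕ → ℕ → ℕ
βsearch n zero = zero
βsearch n (suc k) with ρ (suc k) ∣? n
... | yes _ = suc k
... | no  _ = βsearch n k

-- β(n) = largest positive m < n with ρ(m) ∣ n  (meaningful for n ≥ 2)
β : ℕ → ℕ
β n = βsearch n (n ∸ 1)

βratio : ℕ → ℚ
βratio zero = 0ℚ
βratio (suc k) = (+ β (suc k)) / suc k

{-# OPTIONS --safe #-}
module Submission where

-- Since β(n) < n, the ratio β(n)/n always lies in [0, 1).  Along the primes it tends to 0:
-- each 2 ≤ m < p has a prime factor q < p, and q ∣ ρ(m), so ρ(m) ∤ p and β(p) = 1.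
-- Along n = 2 + 2ᵏ it tends to 1: ρ(2ᵏ) = 2 divides n, so β(n) ≥ 2ᵏ = n − 2.

open import Defs

module Arithmetic where

  open import Data.Nat using (ℕ; zero; suc; _+_; _*_; _∸_; _^_; _≤_; _<_; _≤?_; z≤n; s≤s; s≤s⁻¹; z<s; NonZero; >-nonZero; nonTrivial⇒n>1; _!)
  open import Data.Nat.Properties
  open import Function using (_∘′_)
  open import Data.Nat.Divisibility
  open import Data.Nat.Primality
  open import Data.Nat.Primality.Factorisation using (factorise)
  open import Data.Nat.Combinatorics using (k![n∸k]!∣n!)
  open import Data.Nat.ListAction using (product)
  open import Data.Nat.ListAction.Properties using (∈⇒∣product; product-++)
  open import Data.List using ([]; _∷_; [_]; _++_; filter; upTo)
  open import Data.List.Properties using (upTo-∷ʳ; filter-++; filter-accept; filter-reject; filter-none)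
  open import Data.List.Membership.Propositional.Properties using (∈-filter⁺; ∈-upTo⁺; ∈-upTo⁻)
  open import Data.List.Relation.Unary.All as All using (_∷_)
  open import Data.Product using (_×_; _,_; ∃-syntax)
  open import Data.Sum using (inj₁; inj₂)
  open import Level using (Level)
  open import Relation.Nullary using (yes; no)
  open import Relation.Nullary.Negation using (contradiction)
  open import Relation.Nullary.Decidable using (_×-dec_)
  open import Relation.Unary using (Pred; Decidable)
  open import Relation.Binary.PropositionalEquality hiding ([_])

  prime⇒≢1 : ∀ {p} → Prime p → p ≢ 1
  prime⇒≢1 pp refl = ¬prime[1] pp

  prime⇒≥2 : ∀ {p} → Prime p → 2 ≤ p
  prime⇒≥2 {p} pp = nonTrivial⇒n>1 p {{prime⇒nonTrivial pp}}

  ∃-prime-∣ : ∀ {m} → 2 ≤ m → ∃[ q ] (Prime q × q ∣ m)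
  ∃-prime-∣ {m} 2≤m with factorise m {{>-nonZero (≤-trans (s≤s z≤n) 2≤m)}}
  ... | record { factors = [] ; isFactorisation = m≡1 } =
    contradiction (subst (2 ≤_) m≡1 2≤m) λ { (s≤s ()) }
  ... | record { factors = q ∷ qs ; isFactorisation = m≡q*qs ; factorsPrime = pq ∷ _ } =
    q , pq , subst (q ∣_) (sym m≡q*qs) (m∣m*n (product qs))

  prime-∣-prime⇒≡ : ∀ {p q} → Prime p → Prime q → q ∣ p → q ≡ p
  prime-∣-prime⇒≡ pp pq q∣p with prime⇒irreducible pp q∣p
  ... | inj₁ q≡1 = contradiction q≡1 (prime⇒≢1 pq)
  ... | inj₂ q≡p = q≡p

  prime-∣-^⇒≡ : ∀ {p q} j → Prime p → Prime q → q ∣ p ^ j → q ≡ p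
  prime-∣-^⇒≡ zero    pp pq q∣1 = contradiction (∣1⇒≡1 q∣1) (prime⇒≢1 pq)
  prime-∣-^⇒≡ (suc j) pp pq q∣p^j with euclidsLemma _ _ pq q∣p^j
  ... | inj₁ q∣p   = prime-∣-prime⇒≡ pp pq q∣p
  ... | inj₂ q∣p^j = prime-∣-^⇒≡ j pp pq q∣p^j

  ∣! : ∀ {m n} .{{_ : NonZero m}} → m ≤ n → m ∣ n !
  ∣! {suc m} {n} m≤n =
    ∣-trans (m∣m*n (m !)) (∣-trans (m∣m*n ((n ∸ suc m) !)) (k![n∸k]!∣n! m≤n))

  -- Euclid: a prime factor of N! + 1 exceeds N.
  prime-above : ∀ N → ∃[ p ] (Prime p × N < p)
  prime-above N with ∃-prime-∣ (+-monoˡ-≤ 1 (1≤n! N))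
  ... | q , pq , q∣N!+1 with q ≤? N
  ... | no q≰N = q , pq , ≰⇒> q≰N
  ... | yes q≤N = contradiction (∣1⇒≡1 (∣m+n∣m⇒∣n q∣N!+1 q∣N!)) (prime⇒≢1 pq)
    where q∣N! = ∣! {{prime⇒nonZero pq}} q≤N

  n<2^n : ∀ n → n < 2 ^ n
  n<2^n zero    = z<s
  n<2^n (suc n) = +-mono-≤ (m^n>0 2 n) (≤-trans (n<2^n n) (m≤m+n (2 ^ n) 0))

  module _ {ℓ : Level} {P : Pred ℕ ℓ} (P? : Decidable P) where

    product-filter-upTo-suc : ∀ k →
      product (filter P? (upTo (suc k))) ≡ product (filter P? (upTo k)) * product (filter P? [ k ])
    product-filter-upTo-suc k = begin
      product (filter P? (upTo (suc k)))                       ≡⟨ cong (product ∘′ filter P?) (upTo-∷ʳ k) ⟨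
      product (filter P? (upTo k ++ [ k ]))                    ≡⟨ cong product (filter-++ P? (upTo k) [ k ]) ⟩
      product (filter P? (upTo k) ++ filter P? [ k ])          ≡⟨ product-++ (filter P? (upTo k)) _ ⟩
      product (filter P? (upTo k)) * product (filter P? [ k ]) ∎
      where open ≡-Reasoning

    module _ {p : ℕ} (only-p : ∀ {x} → P x → x ≡ p) where

      filter-upTo-≤ : ∀ {k} → k ≤ p → filter P? (upTo k) ≡ []
      filter-upTo-≤ k≤p = filter-none P? (All.tabulate λ x∈upTo Px →
        <⇒≢ (<-≤-trans (∈-upTo⁻ x∈upTo) k≤p) (only-p Px))

      product-filter-upTo-∣ : ∀ k → product (filter P? (upTo k)) ∣ p
      product-filter-upTo-∣ zero = 1∣ p
      product-filter-upTo-∣ (suc k) with P? k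
      ... | yes Pk = ∣-reflexive (begin
        product (filter P? (upTo (suc k)))                       ≡⟨ product-filter-upTo-suc k ⟩
        product (filter P? (upTo k)) * product (filter P? [ k ]) ≡⟨ cong₂ (λ xs ys → product xs * product ys)
                                                                      (filter-upTo-≤ (≤-reflexive (only-p Pk)))
                                                                      (filter-accept P? Pk) ⟩
        1 * (k * 1)                                              ≡⟨ trans (*-identityˡ (k * 1)) (*-identityʳ k) ⟩
        k                                                        ≡⟨ only-p Pk ⟩
        p                                                        ∎)
        where open ≡-Reasoning
      ... | no ¬Pk = subst (_∣ p) (sym product-unchanged) (product-filter-upTo-∣ k)
        where
        product-unchanged : product (filter P? (upTo (suc k))) ≡ product (filter P? (upTo k))
        product-unchanged = trans (product-filter-upTo-suc k)
          (trans (cong (λ xs → product (filter P? (upTo k)) * product xs) (filter-reject P? ¬Pk))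
            (*-identityʳ _))

  ρ[p^j]∣p : ∀ {p} → Prime p → ∀ j → ρ (p ^ j) ∣ p
  ρ[p^j]∣p {p} pp j = product-filter-upTo-∣ (λ x → prime? x ×-dec x ∣? p ^ j)
    (λ (qx , qx∣p^j) → prime-∣-^⇒≡ j pp qx qx∣p^j) (suc (p ^ j))

  ∣⇒∣ρ : ∀ {q m} .{{_ : NonZero m}} → Prime q → q ∣ m → q ∣ ρ m
  ∣⇒∣ρ {m = m} pq q∣m =
    ∈⇒∣product (∈-filter⁺ (λ x → prime? x ×-dec x ∣? m) (∈-upTo⁺ (s≤s (∣⇒≤ q∣m))) (pq , q∣m))

  ρ∤prime : ∀ {m p} → Prime p → 2 ≤ m → m < p → ρ m ∤ p
  ρ∤prime pp 2≤m@(s≤s (s≤s _)) m<p ρm∣p with ∃-prime-∣ 2≤m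
  ... | q , pq , q∣m = <⇒≱ m<p (subst (_≤ _) q≡p (∣⇒≤ q∣m))
    where q≡p = prime-∣-prime⇒≡ pp pq (∣-trans (∣⇒∣ρ pq q∣m) ρm∣p)

  βsearch-≤ : ∀ n k → βsearch n k ≤ k
  βsearch-≤ n zero = z≤n
  βsearch-≤ n (suc k) with ρ (suc k) ∣? n
  ... | yes _ = ≤-refl
  ... | no  _ = m≤n⇒m≤1+n (βsearch-≤ n k)

  ≤-βsearch : ∀ {n k m} .{{_ : NonZero m}} → m ≤ k → ρ m ∣ n → m ≤ βsearch n k
  ≤-βsearch {k = zero} {m = suc _} ()
  ≤-βsearch {n} {suc k} m≤1+k ρm∣n with ρ (suc k) ∣? n
  ... | yes _ = m≤1+k
  ... | no ρ[1+k]∤n with m≤n⇒m<n∨m≡n m≤1+k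
  ... | inj₁ m<1+k = ≤-βsearch (s≤s⁻¹ m<1+k) ρm∣n
  ... | inj₂ refl  = contradiction ρm∣n ρ[1+k]∤n

  βsearch-≤1 : ∀ {n} k → (∀ {m} → 2 ≤ m → m ≤ k → ρ m ∤ n) → βsearch n k ≤ 1
  βsearch-≤1 zero _ = z≤n
  βsearch-≤1 {n} (suc k) ρ∤n with ρ (suc k) ∣? n
  βsearch-≤1 (suc zero)    _   | yes _         = ≤-refl
  βsearch-≤1 (suc (suc k)) ρ∤n | yes ρ[2+k]∣n = contradiction ρ[2+k]∣n (ρ∤n (s≤s (s≤s z≤n)) ≤-refl)
  βsearch-≤1 (suc k)       ρ∤n | no _          = βsearch-≤1 k λ 2≤m m≤k → ρ∤n 2≤m (m≤n⇒m≤1+n m≤k)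

  β[1+n]≤n : ∀ n → β (suc n) ≤ n
  β[1+n]≤n n = βsearch-≤ (suc n) n

  β[p]≤1 : ∀ {p} → Prime p → β p ≤ 1
  β[p]≤1 {zero}  _  = z≤n
  β[p]≤1 {suc k} pp = βsearch-≤1 k λ 2≤m m≤k → ρ∤prime pp 2≤m (s≤s m≤k)

  p^[1+j]≤β[p+p^[1+j]] : ∀ {p} j → Prime p → p ^ suc j ≤ β (p + p ^ suc j)
  p^[1+j]≤β[p+p^[1+j]] {zero}  j _  = z≤n
  p^[1+j]≤β[p+p^[1+j]] {suc k} j pp = ≤-βsearch {{m^n≢0 (suc k) (suc j)}} (m≤n+m _ k)
    (∣-trans (ρ[p^j]∣p pp (suc j)) (∣m∣n⇒∣m+n ∣-refl (m∣m*n (suc k ^ j))))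

open Arithmetic using (prime-above; prime⇒≥2; n<2^n; β[1+n]≤n; β[p]≤1; p^[1+j]≤β[p+p^[1+j]])

open import Data.Nat as ℕ using (ℕ; zero; suc; _≤_; z≤n; s≤s)
import Data.Nat.Properties as ℕ
open import Data.Integer as ℤ using (+_; +<+; -[1+_])
import Data.Integer.Properties as ℤ
open import Data.Rational using (ℚ; mkℚ; 0ℚ; 1ℚ; _<_; _+_; _-_; -_; _/_; toℚᵘ; *<*)
open import Data.Rational.Properties
open import Data.Rational.Unnormalised as ℚᵘ using (mkℚᵘ)
import Data.Rational.Unnormalised.Properties as ℚᵘ
open import Data.Product using (_×_; _,_; ∃-syntax; ∃₂)
open import Data.Nat.Primality using (prime[2])
open import Relation.Binary.PropositionalEquality

positive⇒fraction : ∀ {ε} → 0ℚ < ε → ∃₂ λ c d → ε ≡ + suc c / suc d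
positive⇒fraction {mkℚ (+ suc c) d _} _ = c , d , sym (↥p/↧p≡p _)
positive⇒fraction {mkℚ (+ zero) _ _} (*<* (+<+ ()))
positive⇒fraction {mkℚ -[1+ _ ] _ _} (*<* ())

toℚᵘ-/ : ∀ u k → toℚᵘ (+ u / suc k) ℚᵘ.≃ mkℚᵘ (+ u) k
toℚᵘ-/ u k = toℚᵘ-fromℚᵘ (mkℚᵘ (+ u) k)

/-mono-< : ∀ {u v k l} → u ℕ.* suc l ℕ.< v ℕ.* suc k → + u / suc k < + v / suc l
/-mono-< {u} {v} {k} {l} ul<vk = toℚᵘ-cancel-<
  (ℚᵘ.<-respˡ-≃ (ℚᵘ.≃-sym (toℚᵘ-/ u k)) (ℚᵘ.<-respʳ-≃ (ℚᵘ.≃-sym (toℚᵘ-/ v l))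
    (ℚᵘ.*<* (subst₂ ℤ._<_ (ℤ.pos-* u (suc l)) (ℤ.pos-* v (suc k)) (+<+ ul<vk)))))

1<[/]+[/] : ∀ {u v k l} → suc k ℕ.* suc l ℕ.< u ℕ.* suc l ℕ.+ v ℕ.* suc k → 1ℚ < + u / suc k + + v / suc l
1<[/]+[/] {u} {v} {k} {l} kl<ul+vk = toℚᵘ-cancel-< (ℚᵘ.<-respʳ-≃ (ℚᵘ.≃-sym toℚᵘ-sum)
  (ℚᵘ.*<* (subst₂ ℤ._<_ (sym (ℤ.*-identityˡ _)) (sym pos-cross-sum) (+<+ kl<ul+vk))))
  where
  toℚᵘ-sum : toℚᵘ (+ u / suc k + + v / suc l) ℚᵘ.≃ mkℚᵘ (+ u) k ℚᵘ.+ mkℚᵘ (+ v) l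
  toℚᵘ-sum = ℚᵘ.≃-trans (toℚᵘ-homo-+ (+ u / suc k) (+ v / suc l))
    (ℚᵘ.+-cong (toℚᵘ-/ u k) (toℚᵘ-/ v l))
  pos-cross-sum : (+ u ℤ.* + suc l ℤ.+ + v ℤ.* + suc k) ℤ.* + 1 ≡ + (u ℕ.* suc l ℕ.+ v ℕ.* suc k)
  pos-cross-sum = begin
    (+ u ℤ.* + suc l ℤ.+ + v ℤ.* + suc k) ℤ.* + 1 ≡⟨ ℤ.*-identityʳ _ ⟩
    + u ℤ.* + suc l ℤ.+ + v ℤ.* + suc k           ≡⟨ cong₂ ℤ._+_ (ℤ.pos-* u (suc l)) (ℤ.pos-* v (suc k)) ⟨
    + (u ℕ.* suc l) ℤ.+ + (v ℕ.* suc k)           ≡⟨ ℤ.pos-+ (u ℕ.* suc l) (v ℕ.* suc k) ⟨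
    + (u ℕ.* suc l ℕ.+ v ℕ.* suc k)               ∎
    where open ≡-Reasoning

p<q+r⇒p-r<q : ∀ {p q r} → p < q + r → p - r < q
p<q+r⇒p-r<q {p} {q} {r} p<q+r = subst (p - r <_) q+r-r≡q (+-monoˡ-< (- r) p<q+r)
  where
  q+r-r≡q : q + r - r ≡ q
  q+r-r≡q = trans (+-assoc q r (- r)) (trans (cong (λ x → q + x) (+-inverseʳ r)) (+-identityʳ q))

-ε<βratio : ∀ {ε} → 0ℚ < ε → ∀ {n} → 2 ≤ n → - ε < βratio n
-ε<βratio 0<ε {suc k} _ =
  <-≤-trans (neg-antimono-< 0<ε) (nonNegative⁻¹ _ {{normalize-nonNeg (β (suc k)) (suc k)}})

βratio<1+ε : ∀ {ε} → 0ℚ < ε → ∀ {n} → 2 ≤ n → βratio n < 1ℚ + ε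
βratio<1+ε {ε} 0<ε {suc k} _ = <-trans βratio<1 (subst (_< 1ℚ + ε) (+-identityʳ 1ℚ) (+-monoʳ-< 1ℚ 0<ε))
  where
  βratio<1 : βratio (suc k) < 1ℚ
  βratio<1 = /-mono-< {β (suc k)} {1} {k} {0}
    (subst₂ ℕ._<_ (sym (ℕ.*-identityʳ _)) (sym (ℕ.*-identityˡ _)) (s≤s (β[1+n]≤n k)))

βratio<ε-at-large-prime : ∀ {ε} → 0ℚ < ε → ∀ N → ∃[ n ] (2 ≤ n × N ≤ n × βratio n < ε)
βratio<ε-at-large-prime 0<ε N with positive⇒fraction 0<ε
... | c , d , refl with prime-above (N ℕ.+ suc d)
... | suc k , pp , N+d<p =
  suc k , prime⇒≥2 pp , ℕ.<⇒≤ (ℕ.≤-<-trans (ℕ.m≤m+n N (suc d)) N+d<p) , /-mono-< {β (suc k)} {suc c} {k} {d} βp*d<c*p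
  where
  open ℕ.≤-Reasoning
  βp*d<c*p : β (suc k) ℕ.* suc d ℕ.< suc c ℕ.* suc k
  βp*d<c*p = begin-strict
    β (suc k) ℕ.* suc d ≤⟨ ℕ.*-monoˡ-≤ (suc d) (β[p]≤1 pp) ⟩
    1 ℕ.* suc d         ≡⟨ ℕ.*-identityˡ (suc d) ⟩
    suc d               ≤⟨ ℕ.m≤n+m (suc d) N ⟩
    N ℕ.+ suc d         <⟨ N+d<p ⟩
    suc k               ≤⟨ ℕ.m≤m+n (suc k) (c ℕ.* suc k) ⟩
    suc c ℕ.* suc k     ∎

1-ε<βratio-at-2+2^k : ∀ {ε} → 0ℚ < ε → ∀ N → ∃[ n ] (2 ≤ n × N ≤ n × 1ℚ - ε < βratio n)
1-ε<βratio-at-2+2^k 0<ε N with positive⇒fraction 0<ε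
... | c , d , refl =
  n , s≤s (s≤s z≤n) , ℕ.≤-trans (ℕ.m≤m+n N _) (ℕ.<⇒≤ X<n) , p<q+r⇒p-r<q (1<[/]+[/] {β n} {suc c} {suc m} {d} n*d<β*d+c*n)
  where
  open ℕ.≤-Reasoning
  X m n : ℕ
  X = N ℕ.+ 2 ℕ.* suc d
  m = 2 ℕ.^ suc X
  n = 2 ℕ.+ m
  m≤βn : m ≤ β n
  m≤βn = p^[1+j]≤β[p+p^[1+j]] X prime[2]
  X<n : X ℕ.< n
  X<n = ℕ.<-≤-trans (n<2^n X) (ℕ.≤-trans (ℕ.^-monoʳ-≤ 2 (ℕ.n≤1+n X)) (ℕ.m≤n+m m 2))
  n*d<β*d+c*n : n ℕ.* suc d ℕ.< β n ℕ.* suc d ℕ.+ suc c ℕ.* n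
  n*d<β*d+c*n = begin-strict
    n ℕ.* suc d                   ≡⟨ ℕ.*-distribʳ-+ (suc d) 2 m ⟩
    2 ℕ.* suc d ℕ.+ m ℕ.* suc d   ≤⟨ ℕ.+-monoʳ-≤ (2 ℕ.* suc d) (ℕ.*-monoˡ-≤ (suc d) m≤βn) ⟩
    2 ℕ.* suc d ℕ.+ β n ℕ.* suc d <⟨ ℕ.+-monoˡ-< (β n ℕ.* suc d) (ℕ.≤-<-trans (ℕ.m≤n+m _ N) X<n) ⟩
    n ℕ.+ β n ℕ.* suc d           ≤⟨ ℕ.+-monoˡ-≤ (β n ℕ.* suc d) (ℕ.m≤m+n n (c ℕ.* n)) ⟩
    suc c ℕ.* n ℕ.+ β n ℕ.* suc d ≡⟨ ℕ.+-comm (suc c ℕ.* n) _ ⟩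
    β n ℕ.* suc d ℕ.+ suc c ℕ.* n ∎

proposition3p1 : ((∀ (ε : ℚ) → 0ℚ < ε → ∃[ N ] (∀ (n : ℕ) → 2 ≤ n → N ≤ n → (- ε) < βratio n))
    × (∀ (ε : ℚ) → 0ℚ < ε → ∀ (N : ℕ) → ∃[ n ] (2 ≤ n × N ≤ n × βratio n < ε)))
    × ((∀ (ε : ℚ) → 0ℚ < ε → ∃[ N ] (∀ (n : ℕ) → 2 ≤ n → N ≤ n → βratio n < 1ℚ + ε))
    × (∀ (ε : ℚ) → 0ℚ < ε → ∀ (N : ℕ) → ∃[ n ] (2 ≤ n × N ≤ n × 1ℚ - ε < βratio n)))
proposition3p1 =
  ( (λ _ 0<ε → 0 , λ _ 2≤n _ → -ε<βratio 0<ε 2≤n)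
  , (λ _ → βratio<ε-at-large-prime) )
  , ( (λ _ 0<ε → 0 , λ _ 2≤n _ → βratio<1+ε 0<ε 2≤n)
  , (λ _ → 1-ε<βratio-at-2+2^k) )
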